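{- Let $H$ be a reduced Thomas-Walls graph drawn in the plane. Then $H$ has four $3$-colourings $\varphi_1,\dots,\varphi_4$ such that for each face of $H$ bounded by a $5$-cycle $K$, there is only one vertex of $K$ that is not the pivot of $K$ in any of $\varphi_1,\dots,\varphi_4$. Moreover, for every vertex $u\in V(H)$ of degree three and any pair of its neighbors, there exists $i\in\{1,\dots,4\}$ such that the two vertices of the pair receive the same colour in $\varphi_i$ and the third neighbor of $u$ receives a different colour.
   Context: Thomas-Walls graphs: $T_1=K_4$; for $k\ge1$, for an edge $u_1u_3$ of $T_k$ lying in two triangles, $T_{k+1}$ is obtained from $T_k-u_1u_3$ by adding vertices $x,y,z$ and edges $u_1x,u_3y,u_3z,xy,xz,yz$. For $k\ge2$, $T_k$ has unique $4$-cycles $u_1u_2u_3u_4$ and $v_1v_2v_3v_4$ with $u_1u_3,v_1v_3\in E(T_k)$; the reduced Thomas-Walls graph is $T'_k=T_k-\{u_1u_3,v_1v_3\}$, and $T'_1$ is a $4$-cycle. In any $3$-colouring of a $5$-cycle $K$ there is a unique vertex whose colour appears exactly once on $K$; this vertex is the pivot of the $3$-colouring on $K$. -}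

module Defs where

open import Data.Nat using (ℕ; zero; suc; _+_; _*_; _≡ᵇ_)
open import Data.Bool using (Bool; true; false; _∧_; _∨_; not; T; if_then_else_)
open import Data.List using (List; []; _∷_; _++_; length; map; allFin; lookup)
open import Data.Bool.ListAction using (any)
open import Data.Nat.ListAction using (sum)
open import Data.List.Relation.Unary.All using (All)
open import Data.List.Relation.Unary.Any using (Any)
open import Data.Product using (_×_; _,_; proj₁; proj₂; Σ; ∃)
open import Data.Fin using (Fin; toℕ)
import Data.Fin as F
open import Relation.Nullary using (¬_)
open import Relation.Nullary.Decidable using (⌊_⌋)
open import Relation.Binary.PropositionalEquality using (_≡_; _≢_)

Edge : Set
Edge = ℕ × ℕ

record Graph : Set where
  field
    n : ℕ
    E : List Edge
open Graph public

sameEdgeB : Edge → Edge → Bool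
sameEdgeB (a , b) (c , d) = ((a ≡ᵇ c) ∧ (b ≡ᵇ d)) ∨ ((a ≡ᵇ d) ∧ (b ≡ᵇ c))

adjB : List Edge → ℕ → ℕ → Bool
adjB es u v = any (sameEdgeB (u , v)) es

Adj : (G : Graph) → Fin (n G) → Fin (n G) → Set
Adj G u v = T (adjB (E G) (toℕ u) (toℕ v))

-- number of edges (the edge lists below contain no repeated edge)
numEdges : Graph → ℕ
numEdges G = length (E G)

removeEdges : List Edge → List Edge → List Edge
removeEdges rs [] = []
removeEdges rs (e ∷ es) =
  if any (sameEdgeB e) rs then removeEdges rs es else e ∷ removeEdges rs es

-- Index m corresponds to T_{m+1}, with vertices
-- 0 , … , 3m+3.  T_1 = K_4 on {0,1,2,3}.  At each step the edge
-- active m = u1u3 (lying in two triangles) is replaced: new vertices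
-- x = 3m+4, y = 3m+5, z = 3m+6 and edges u1x, u3y, u3z, xy, xz, yz.
-- The new edge yz is the next active edge.  The edge 13 of K_4 is the
-- other edge lying in two triangles and is never touched.

nV : ℕ → ℕ
nV m = 3 * m + 4

active : ℕ → Edge
active zero = (0 , 2)
active (suc m) = (3 * m + 5 , 3 * m + 6)

fixedChord : Edge
fixedChord = (1 , 3)

core : ℕ → List Edge
core zero = (0 , 1) ∷ (1 , 2) ∷ (2 , 3) ∷ (3 , 0) ∷ (1 , 3) ∷ []
core (suc m) with active m
... | (u1 , u3) =
  core m ++ ((u1 , x) ∷ (u3 , y) ∷ (u3 , z) ∷ (x , y) ∷ (x , z) ∷ [])
  where
    x = 3 * m + 4
    y = 3 * m + 5
    z = 3 * m + 6

TW : ℕ → Graph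
TW m = record { n = nV m ; E = active m ∷ core m }

-- the reduced Thomas-Walls graph T'_{m+1} = T_{m+1} - {u1u3 , v1v3},
-- where u1u3 = active m and v1v3 = fixedChord are the chords of the two
-- unique 4-cycles; for m = 0 this gives the 4-cycle 0123 = T'_1.
RTW : ℕ → Graph
RTW m = record { n = nV m ; E = removeEdges (active m ∷ fixedChord ∷ []) (E (TW m)) }

-- Plane embeddings as genus-0 rotation systems (combinatorial maps).

iter : {A : Set} → (A → A) → ℕ → A → A
iter f zero a = a
iter f (suc k) a = f (iter f k a)

Dart : Graph → Set
Dart G = Fin (n G) × Fin (n G)

IsDart : (G : Graph) → Dart G → Set
IsDart G (u , v) = Adj G u v

faceNext : (G : Graph) → (Fin (n G) → Fin (n G) → Fin (n G)) → Dart G → Dart G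
faceNext G rot (u , v) = (v , rot v u)

SameFace : (G : Graph) → (Fin (n G) → Fin (n G) → Fin (n G)) → Dart G → Dart G → Set
SameFace G rot d d' = ∃ λ i → iter (faceNext G rot) i d ≡ d'

record PlaneEmbedding (G : Graph) : Set where
  field
    rot        : Fin (n G) → Fin (n G) → Fin (n G)
    rot-closed : ∀ v u → Adj G v u → Adj G v (rot v u)
    rot-inj    : ∀ v u w → Adj G v u → Adj G v w → rot v u ≡ rot v w → u ≡ w
    rot-cyclic : ∀ v u w → Adj G v u → Adj G v w → ∃ λ i → iter (rot v) i u ≡ w
    faceReps       : List (Dart G)
    reps-darts     : All (IsDart G) faceReps
    reps-cover     : ∀ d → IsDart G d → Any (λ r → SameFace G rot r d) faceReps
    reps-distinct  : ∀ i j → SameFace G rot (lookup faceReps i) (lookup faceReps j) → i ≡ j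
    euler          : n G + length faceReps ≡ numEdges G + 2
open PlaneEmbedding public

faceVertex : (G : Graph) → PlaneEmbedding G → Dart G → Fin 5 → Fin (n G)
faceVertex G emb d j = proj₁ (iter (faceNext G (rot emb)) (toℕ j) d)

FiveFace : (G : Graph) → PlaneEmbedding G → Dart G → Set
FiveFace G emb d =
  IsDart G d
  × iter (faceNext G (rot emb)) 5 d ≡ d
  × (∀ i j → faceVertex G emb d i ≡ faceVertex G emb d j → i ≡ j)

Colouring : Graph → Set
Colouring G = Fin (n G) → Fin 3

Proper : (G : Graph) → Colouring G → Set
Proper G φ = ∀ u v → Adj G u v → φ u ≢ φ v

colourCount : {A : Set} → (A → Fin 3) → (Fin 5 → A) → Fin 3 → ℕ
colourCount φ K c = sum (map (λ j → if ⌊ φ (K j) F.≟ c ⌋ then 1 else 0) (allFin 5))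

IsPivot : {A : Set} → (A → Fin 3) → (Fin 5 → A) → Fin 5 → Set
IsPivot φ K j = colourCount φ K (φ (K j)) ≡ 1

module Submission where

-- In the labelling of RTW m = T'_{m+1}, every step of the construction appends a gadget of
-- three vertices to the initial square 0123, so the labels 3j+4, 3j+5, 3j+6 form the j-th
-- gadget.  Edges join labels at most 4 apart, and away from both ends of the chain the graph
-- is invariant under shifting all labels by 12 (four gadgets).  The four colourings are
-- periodic with the same period.  Hence every edge, closed walk of length 5 and degree-3
-- neighbourhood of T'_{m+1} with m ≥ 9 either lies among the labels ≤ 25, where T'_{m+1}
-- agrees with T'_9, or is the translate by 12 of one in T'_{m-3}.  This reduces the theorem
-- to the graphs T'_1, …, T'_9, which are checked by exhaustive search.

open import Defs
open import Data.Nat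
  using (ℕ; zero; suc; _+_; _*_; _∸_; _≡ᵇ_; _<_; _≤_; _≤′_; ≤′-refl; ≤′-step; _<?_; _≤?_; z<s; s<s)
import Data.Nat as ℕ
open import Data.Nat.Properties
  using ( ≡ᵇ⇒≡; <⇒≢; <⇒≤; <⇒≱; ≮⇒≥; ≤-trans; ≤-<-trans; <-≤-trans; n≤1+n; m≤m+n; m≤n+m
        ; +-monoʳ-≤; +-monoˡ-≤; +-monoʳ-<; *-monoʳ-≤; +-assoc; m+n≮m
        ; m+[n∸m]≡n; ≤′⇒≤; ≤⇒≤′)
open import Data.Nat.Tactic.RingSolver using (solve-∀)
open import Data.Nat.ListAction using (sum)
open import Data.Bool using (Bool; true; false; _∧_; _∨_; not; T; if_then_else_)
open import Data.Bool.Properties using (∨-comm; ∧-comm; ∨-assoc; ∧-zeroʳ; ∨-identityʳ; ¬-not; T-≡; T-∧; T-∨; T?)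
open import Data.Bool.ListAction using (any; or)
open import Data.List using (List; []; _∷_; _++_; map; filter; upTo; applyUpTo; allFin)
open import Data.List.Properties using (map-cong; map-∘)
open import Data.List.Relation.Unary.All as All using (All; []; _∷_; all?)
open import Data.List.Relation.Unary.All.Properties using (++⁺; map⁺)
open import Data.List.Membership.Propositional using (_∈_)
open import Data.List.Membership.Propositional.Properties using (∈-filter⁺; ∈-filter⁻; ∈-upTo⁺)
open import Data.List.Membership.DecPropositional ℕ._≟_ using (_∈?_)
open import Data.Fin using (Fin; toℕ; fromℕ<; #_)
import Data.Fin as F
open import Data.Fin.Properties using (any?; toℕ-injective; toℕ-fromℕ<) renaming (all? to allFin?)
open import Data.Vec using (Vec; lookup; _∷_; [])
open import Data.Product using (Σ; ∃; _×_; _,_; proj₁; proj₂)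
open import Data.Sum as Sum using (_⊎_; inj₁; inj₂; [_,_])
open import Data.Empty using (⊥-elim)
open import Function using (_∘_; Equivalence)
open import Relation.Nullary using (¬_; Dec; yes; no; ¬?)
open import Relation.Nullary.Decidable using (True; toWitness; from-yes; ⌊_⌋; _×-dec_; _⊎-dec_; _→-dec_)
open import Relation.Binary.PropositionalEquality
  using (_≡_; _≢_; refl; sym; trans; cong; cong₂; subst; subst₂; ≢-sym; module ≡-Reasoning)

open Equivalence using (to; from)

¬T⇒≡false : ∀ {b} → ¬ T b → b ≡ false
¬T⇒≡false ¬b = ¬-not (¬b ∘ from T-≡)

≡ᵇ-false : ∀ {m n} → m ≢ n → (m ≡ᵇ n) ≡ false
≡ᵇ-false {m} {n} m≢n = ¬T⇒≡false (m≢n ∘ ≡ᵇ⇒≡ m n)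

+-≡ᵇ : ∀ t {u c} → (t + u ≡ᵇ t + c) ≡ (u ≡ᵇ c)
+-≡ᵇ zero = refl
+-≡ᵇ (suc t) = +-≡ᵇ t

sameEdgeB-sym : ∀ u v e → sameEdgeB (u , v) e ≡ sameEdgeB (v , u) e
sameEdgeB-sym u v (c , d) =
  trans (∨-comm ((u ≡ᵇ c) ∧ (v ≡ᵇ d)) _) (cong₂ _∨_ (∧-comm (u ≡ᵇ d) _) (∧-comm (u ≡ᵇ c) _))

sameEdgeB-sound : ∀ {u v c d} → T (sameEdgeB (u , v) (c , d)) → (u ≡ c × v ≡ d) ⊎ (u ≡ d × v ≡ c)
sameEdgeB-sound {u} {v} {c} {d} t with to T-∨ t
... | inj₁ p = inj₁ (≡ᵇ⇒≡ u c (proj₁ (to T-∧ p)) , ≡ᵇ⇒≡ v d (proj₂ (to T-∧ p)))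
... | inj₂ p = inj₂ (≡ᵇ⇒≡ u d (proj₁ (to T-∧ p)) , ≡ᵇ⇒≡ v c (proj₂ (to T-∧ p)))

sameEdgeB-false : ∀ {u v c d} → u ≢ c → u ≢ d → sameEdgeB (u , v) (c , d) ≡ false
sameEdgeB-false u≢c u≢d rewrite ≡ᵇ-false u≢c | ≡ᵇ-false u≢d = refl

sameEdgeB-trans : ∀ x e r → T (sameEdgeB x e) → sameEdgeB x r ≡ sameEdgeB e r
sameEdgeB-trans (u , v) (c , d) r t with sameEdgeB-sound {u} {v} {c} {d} t
... | inj₁ (refl , refl) = refl
... | inj₂ (refl , refl) = sameEdgeB-sym u v r

adjB-sym : ∀ es u v → adjB es u v ≡ adjB es v u
adjB-sym [] u v = refl
adjB-sym (e ∷ es) u v = cong₂ _∨_ (sameEdgeB-sym u v e) (adjB-sym es u v)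

adjB-++ : ∀ xs ys u v → adjB (xs ++ ys) u v ≡ adjB xs u v ∨ adjB ys u v
adjB-++ [] ys u v = refl
adjB-++ (x ∷ xs) ys u v =
  trans (cong (sameEdgeB (u , v) x ∨_) (adjB-++ xs ys u v)) (sym (∨-assoc (sameEdgeB (u , v) x) _ _))

adjB-sameEdge : ∀ rs u v e → T (sameEdgeB (u , v) e) → adjB rs u v ≡ any (sameEdgeB e) rs
adjB-sameEdge rs u v e t = cong or (map-cong (λ r → sameEdgeB-trans (u , v) e r t) rs)

absorb-removed : ∀ s a x → (T s → T x) → (s ∨ a) ∧ not x ≡ a ∧ not x
absorb-removed false a x _ = refl
absorb-removed true a true _ = sym (∧-zeroʳ a)
absorb-removed true a false s⇒x = ⊥-elim (s⇒x _)

absorb-kept : ∀ s a x → (T s → ¬ T x) → s ∨ (a ∧ not x) ≡ (s ∨ a) ∧ not x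
absorb-kept false a x _ = refl
absorb-kept true a false _ = refl
absorb-kept true a true s⇒¬x = ⊥-elim (s⇒¬x _ _)

adjB-removeEdges : ∀ rs es u v → adjB (removeEdges rs es) u v ≡ adjB es u v ∧ not (adjB rs u v)
adjB-removeEdges rs [] u v = refl
adjB-removeEdges rs (e ∷ es) u v with any (sameEdgeB e) rs in removed
... | true  = trans (adjB-removeEdges rs es u v)
                    (sym (absorb-removed (sameEdgeB (u , v) e) _ _ λ s →
                      from T-≡ (trans (adjB-sameEdge rs u v e s) removed)))
... | false = trans (cong (sameEdgeB (u , v) e ∨_) (adjB-removeEdges rs es u v))
                    (absorb-kept (sameEdgeB (u , v) e) _ _ λ s → subst T (trans (adjB-sameEdge rs u v e s) removed))

adjB-All : ∀ {P : Edge → Set} → (∀ {a b} → P (a , b) → P (b , a)) →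
           ∀ {es u v} → All P es → T (adjB es u v) → P (u , v)
adjB-All P-sym {e ∷ es} {u} {v} (p ∷ ps) t with to T-∨ t
... | inj₂ t′ = adjB-All P-sym ps t′
... | inj₁ s with sameEdgeB-sound {u} {v} {proj₁ e} {proj₂ e} s
...   | inj₁ (refl , refl) = p
...   | inj₂ (refl , refl) = P-sym p

adjB-beyond : ∀ {L es} → All (λ e → proj₁ e < L ⊎ proj₂ e < L) es → ∀ a b → adjB es (L + a) (L + b) ≡ false
adjB-beyond {L} ps a b = ¬T⇒≡false λ t → [ m+n≮m L a , m+n≮m L b ] (adjB-All [ inj₂ , inj₁ ] ps t)

offset : ℕ → Edge → Edge
offset t (a , b) = (t + a , t + b)

offset-+ : ∀ s t e → offset (s + t) e ≡ offset s (offset t e)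
offset-+ s t (a , b) = cong₂ _,_ (+-assoc s t a) (+-assoc s t b)

sameEdgeB-offset : ∀ t u v e → sameEdgeB (t + u , t + v) (offset t e) ≡ sameEdgeB (u , v) e
sameEdgeB-offset t u v (c , d)
  rewrite +-≡ᵇ t {u} {c} | +-≡ᵇ t {v} {d} | +-≡ᵇ t {u} {d} | +-≡ᵇ t {v} {c} = refl

adjB-offset : ∀ t es u v → adjB (map (offset t) es) (t + u) (t + v) ≡ adjB es u v
adjB-offset t [] u v = refl
adjB-offset t (e ∷ es) u v = cong₂ _∨_ (sameEdgeB-offset t u v e) (adjB-offset t es u v)

Above : ℕ → Edge → Set
Above u (a , b) = u < a × u < b

above? : ∀ u e → Dec (Above u e)
above? u (a , b) = (u <? a) ×-dec (u <? b)

above-offset : ∀ {u} t {e} → u ≤ t + 4 → Above 4 e → Above u (offset t e)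
above-offset t u≤ (4<a , 4<b) = ≤-<-trans u≤ (+-monoʳ-< t 4<a) , ≤-<-trans u≤ (+-monoʳ-< t 4<b)

adjB-∷-above : ∀ {u} v e es → Above u e → adjB (e ∷ es) u v ≡ adjB es u v
adjB-∷-above {u} v (c , d) es (u<c , u<d) rewrite sameEdgeB-false {u} {v} (<⇒≢ u<c) (<⇒≢ u<d) = refl

adjB-above : ∀ {u} v {es} → All (Above u) es → adjB es u v ≡ false
adjB-above v [] = refl
adjB-above v {e ∷ es} (p ∷ ps) = trans (adjB-∷-above v e es p) (adjB-above v ps)

adjB-++-above : ∀ {u} v es es′ → All (Above u) es′ → adjB (es ++ es′) u v ≡ adjB es u v
adjB-++-above {u} v es es′ ps =
  trans (adjB-++ es es′ u v) (trans (cong (adjB es u v ∨_) (adjB-above v ps)) (∨-identityʳ _))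

adj : ℕ → ℕ → ℕ → Bool
adj m u v = adjB (E (RTW m)) u v

removed : ℕ → List Edge
removed m = active m ∷ fixedChord ∷ []

adj-removed : ∀ m u v → adj m u v ≡ adjB (E (TW m)) u v ∧ not (adjB (removed m) u v)
adj-removed m = adjB-removeEdges (removed m) (E (TW m))

adj-sym : ∀ m {u v} → T (adj m u v) → T (adj m v u)
adj-sym m {u} {v} = subst T (adjB-sym (E (RTW m)) u v)

adj⇒TW : ∀ m {u v} → T (adj m u v) → T (adjB (E (TW m)) u v)
adj⇒TW m {u} {v} t = proj₁ (to T-∧ (subst T (adj-removed m u v) t))

gadget : ℕ → List Edge
gadget m = (u₁ , x) ∷ (u₃ , y) ∷ (u₃ , z) ∷ (x , y) ∷ (x , z) ∷ []
  where
  u₁ = proj₁ (active m)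
  u₃ = proj₂ (active m)
  x = 3 * m + 4
  y = 3 * m + 5
  z = 3 * m + 6

core-suc : ∀ m → core (suc m) ≡ core m ++ gadget m
core-suc zero = refl
core-suc (suc m) = refl

gadgetShape : List Edge
gadgetShape = (5 , 7) ∷ (6 , 8) ∷ (6 , 9) ∷ (7 , 8) ∷ (7 , 9) ∷ []

three-suc : ∀ k c → 3 * suc k + c ≡ 3 * k + (3 + c)
three-suc = solve-∀

gadget-suc : ∀ k → gadget (suc k) ≡ map (offset (3 * k)) gadgetShape
gadget-suc k rewrite three-suc k 4 | three-suc k 5 | three-suc k 6 = refl

active-suc-suc : ∀ k → active (suc (suc k)) ≡ offset (3 * k) (8 , 9)
active-suc-suc k = cong₂ _,_ (three-suc k 5) (three-suc k 6)

Near : Edge → Set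
Near (a , b) = a ≤ 4 + b × b ≤ 4 + a

near? : ∀ e → Dec (Near e)
near? (a , b) = (a ≤? 4 + b) ×-dec (b ≤? 4 + a)

near-offset : ∀ t {e} → Near e → Near (offset t e)
near-offset t {a , b} (a≤ , b≤) =
  subst (t + a ≤_) (swap t b) (+-monoʳ-≤ t a≤) , subst (t + b ≤_) (swap t a) (+-monoʳ-≤ t b≤)
  where
  swap : ∀ t b → t + (4 + b) ≡ 4 + (t + b)
  swap = solve-∀

near-gadget : ∀ m → All Near (gadget m)
near-gadget zero = from-yes (all? near? (gadget 0))
near-gadget (suc k) = subst (All Near) (sym (gadget-suc k))
  (map⁺ (All.map (near-offset (3 * k)) (from-yes (all? near? gadgetShape))))

near-core : ∀ m → All Near (core m)
near-core zero = from-yes (all? near? (core 0))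
near-core (suc m) = subst (All Near) (sym (core-suc m)) (++⁺ (near-core m) (near-gadget m))

near-active : ∀ m → Near (active m)
near-active zero = from-yes (near? (0 , 2))
near-active (suc k) = near-offset (3 * k) (from-yes (near? (5 , 6)))

adj-near : ∀ m {u v} → T (adj m u v) → v ≤ 4 + u
adj-near m {u} {v} t =
  proj₂ (adjB-All (λ (p , q) → q , p) {E (TW m)} {u} {v} (near-active m ∷ near-core m) (adj⇒TW m {u} {v} t))

Below : ℕ → Edge → Set
Below N (a , b) = a < N × b < N

below? : ∀ N e → Dec (Below N e)
below? N (a , b) = (a <? N) ×-dec (b <? N)

below-offset : ∀ t {N e} → Below N e → Below (t + N) (offset t e)
below-offset t {e = a , b} (a< , b<) = +-monoʳ-< t a< , +-monoʳ-< t b<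

below-mono : ∀ {N N′} → N ≤ N′ → ∀ {e} → Below N e → Below N′ e
below-mono N≤N′ {a , b} (a< , b<) = <-≤-trans a< N≤N′ , <-≤-trans b< N≤N′

nV-suc : ∀ k → nV (suc k) ≡ 3 * k + 7
nV-suc k = three-suc k 4

below-gadget : ∀ m → All (Below (nV (suc m))) (gadget m)
below-gadget zero = from-yes (all? (below? 7) (gadget 0))
below-gadget (suc k) = subst₂ (λ N es → All (Below N) es) (sym (nV-suc-suc k)) (sym (gadget-suc k))
  (map⁺ (All.map (below-offset (3 * k)) (from-yes (all? (below? 10) gadgetShape))))
  where
  nV-suc-suc : ∀ k → 3 * suc (suc k) + 4 ≡ 3 * k + 10
  nV-suc-suc = solve-∀

below-core : ∀ m → All (Below (nV m)) (core m)
below-core zero = from-yes (all? (below? 4) (core 0))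
below-core (suc m) = subst (All (Below (nV (suc m)))) (sym (core-suc m))
  (++⁺ (All.map (below-mono (+-monoˡ-≤ 4 (*-monoʳ-≤ 3 (n≤1+n m)))) (below-core m)) (below-gadget m))

below-active : ∀ m → Below (nV m) (active m)
below-active zero = from-yes (below? 4 (0 , 2))
below-active (suc k) =
  subst (λ N → Below N (active (suc k))) (sym (nV-suc k)) (below-offset (3 * k) (from-yes (below? 7 (5 , 6))))

adj-bounded : ∀ m {u v} → T (adj m u v) → v < nV m
adj-bounded m {u} {v} t =
  proj₂ (adjB-All (λ (p , q) → q , p) {E (TW m)} {u} {v} (below-active m ∷ below-core m) (adj⇒TW m {u} {v} t))

adj-truncate-step : ∀ j {u} v → u ≤ 3 * j + 4 → adj (suc (suc j)) u v ≡ adj (suc j) u v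
adj-truncate-step j {u} v u≤ = begin
  adj (suc (suc j)) u v                                                    ≡⟨ adj-removed (suc (suc j)) u v ⟩
  adjB (E (TW (suc (suc j)))) u v ∧ not (adjB (removed (suc (suc j))) u v) ≡⟨ cong₂ (λ x y → x ∧ not y) edges removals ⟩
  adjB (E (TW (suc j))) u v ∧ not (adjB (removed (suc j)) u v)             ≡⟨ sym (adj-removed (suc j) u v) ⟩
  adj (suc j) u v                                                          ∎
  where
  open ≡-Reasoning
  above-new : Above u (active (suc (suc j)))
  above-new = subst (Above u) (sym (active-suc-suc j)) (above-offset (3 * j) u≤ (from-yes (above? 4 (8 , 9))))
  above-old : Above u (active (suc j))
  above-old = above-offset (3 * j) u≤ (from-yes (above? 4 (5 , 6)))
  above-gadget : All (Above u) (gadget (suc j))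
  above-gadget = subst (All (Above u)) (sym (gadget-suc j))
    (map⁺ (All.map (above-offset (3 * j) u≤) (from-yes (all? (above? 4) gadgetShape))))
  edges : adjB (E (TW (suc (suc j)))) u v ≡ adjB (E (TW (suc j))) u v
  edges = begin
    adjB (active (suc (suc j)) ∷ core (suc j) ++ gadget (suc j)) u v
      ≡⟨ adjB-∷-above v (active (suc (suc j))) (core (suc j) ++ gadget (suc j)) above-new ⟩
    adjB (core (suc j) ++ gadget (suc j)) u v
      ≡⟨ adjB-++-above v (core (suc j)) (gadget (suc j)) above-gadget ⟩
    adjB (core (suc j)) u v
      ≡⟨ sym (adjB-∷-above v (active (suc j)) (core (suc j)) above-old) ⟩
    adjB (active (suc j) ∷ core (suc j)) u v
      ∎
  removals : adjB (removed (suc (suc j))) u v ≡ adjB (removed (suc j)) u v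
  removals = trans (adjB-∷-above v (active (suc (suc j))) (fixedChord ∷ []) above-new)
                   (sym (adjB-∷-above v (active (suc j)) (fixedChord ∷ []) above-old))

adj-truncate : ∀ {j n} → j ≤ n → ∀ {u} v → u ≤ 3 * j + 4 → adj (suc n) u v ≡ adj (suc j) u v
adj-truncate {j} j≤n {u} v u≤ = go (≤⇒≤′ j≤n)
  where
  go : ∀ {n} → j ≤′ n → adj (suc n) u v ≡ adj (suc j) u v
  go ≤′-refl = refl
  go (≤′-step {n} j≤′n) =
    trans (adj-truncate-step n v (≤-trans u≤ (+-monoˡ-≤ 4 (*-monoʳ-≤ 3 (≤′⇒≤ j≤′n))))) (go j≤′n)

gadget-offset : ∀ k → gadget (5 + k) ≡ map (offset 12) (gadget (1 + k))
gadget-offset k = begin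
  gadget (5 + k)                                     ≡⟨ gadget-suc (4 + k) ⟩
  map (offset (3 * (4 + k))) gadgetShape             ≡⟨ cong (λ t → map (offset t) gadgetShape) (twelve k) ⟩
  map (offset (12 + 3 * k)) gadgetShape              ≡⟨ map-cong (offset-+ 12 (3 * k)) gadgetShape ⟩
  map (offset 12 ∘ offset (3 * k)) gadgetShape       ≡⟨ map-∘ {g = offset 12} {f = offset (3 * k)} gadgetShape ⟩
  map (offset 12) (map (offset (3 * k)) gadgetShape) ≡⟨ cong (map (offset 12)) (sym (gadget-suc k)) ⟩
  map (offset 12) (gadget (1 + k))                   ∎
  where
  open ≡-Reasoning
  twelve : ∀ k → 3 * (4 + k) ≡ 12 + 3 * k
  twelve = solve-∀

active-offset : ∀ k → active (5 + k) ≡ offset 12 (active (1 + k))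
active-offset k = cong₂ _,_ (shift k 5) (shift k 6)
  where
  shift : ∀ k c → 3 * (4 + k) + c ≡ 12 + (3 * k + c)
  shift = solve-∀

core-shift : ∀ k a b → adjB (core (5 + k)) (17 + a) (17 + b) ≡ adjB (core (1 + k)) (5 + a) (5 + b)
core-shift zero a b =
  trans (adjB-beyond (from-yes (all? (low? 17) (core 5))) a b)
        (sym (adjB-beyond (from-yes (all? (low? 5) (core 1))) a b))
  where
  low? : ∀ L e → Dec (proj₁ e < L ⊎ proj₂ e < L)
  low? L e = (proj₁ e <? L) ⊎-dec (proj₂ e <? L)
core-shift (suc k) a b = begin
  adjB (core (5 + k) ++ gadget (5 + k)) (17 + a) (17 + b)
    ≡⟨ adjB-++ (core (5 + k)) (gadget (5 + k)) (17 + a) (17 + b) ⟩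
  adjB (core (5 + k)) (17 + a) (17 + b) ∨ adjB (gadget (5 + k)) (17 + a) (17 + b)
    ≡⟨ cong₂ _∨_ (core-shift k a b) gadgets ⟩
  adjB (core (1 + k)) (5 + a) (5 + b) ∨ adjB (gadget (1 + k)) (5 + a) (5 + b)
    ≡⟨ sym (adjB-++ (core (1 + k)) (gadget (1 + k)) (5 + a) (5 + b)) ⟩
  adjB (core (1 + k) ++ gadget (1 + k)) (5 + a) (5 + b)
    ∎
  where
  open ≡-Reasoning
  gadgets : adjB (gadget (5 + k)) (17 + a) (17 + b) ≡ adjB (gadget (1 + k)) (5 + a) (5 + b)
  gadgets = trans (cong (λ es → adjB es (17 + a) (17 + b)) (gadget-offset k))
                  (adjB-offset 12 (gadget (1 + k)) (5 + a) (5 + b))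

adj-shift : ∀ k a b → adj (5 + k) (17 + a) (17 + b) ≡ adj (1 + k) (5 + a) (5 + b)
-- The fixed chord 13 contributes nothing on either side: it reduces to false on labels ≥ 5.
adj-shift k a b = begin
  adj (5 + k) (17 + a) (17 + b)                                      ≡⟨ adj-removed (5 + k) (17 + a) (17 + b) ⟩
  (new ∨ adjB (core (5 + k)) (17 + a) (17 + b)) ∧ not (new ∨ false)
    ≡⟨ cong₂ (λ s c → (s ∨ c) ∧ not (s ∨ false)) actives (core-shift k a b) ⟩
  (old ∨ adjB (core (1 + k)) (5 + a) (5 + b)) ∧ not (old ∨ false)    ≡⟨ sym (adj-removed (1 + k) (5 + a) (5 + b)) ⟩
  adj (1 + k) (5 + a) (5 + b)                                        ∎
  where
  open ≡-Reasoning
  new old : Bool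
  new = sameEdgeB (17 + a , 17 + b) (active (5 + k))
  old = sameEdgeB (5 + a , 5 + b) (active (1 + k))
  actives : new ≡ old
  actives = trans (cong (sameEdgeB (17 + a , 17 + b)) (active-offset k))
                  (sameEdgeB-offset 12 (5 + a) (5 + b) (active (1 + k)))

palette : ℕ → Vec (Fin 3) 4
palette 0  = # 0 ∷ # 0 ∷ # 0 ∷ # 0 ∷ []
palette 1  = # 1 ∷ # 1 ∷ # 1 ∷ # 1 ∷ []
palette 2  = # 0 ∷ # 0 ∷ # 2 ∷ # 2 ∷ []
palette 3  = # 2 ∷ # 2 ∷ # 1 ∷ # 1 ∷ []
palette 4  = # 1 ∷ # 2 ∷ # 2 ∷ # 2 ∷ []
palette 5  = # 2 ∷ # 1 ∷ # 0 ∷ # 1 ∷ []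
palette 6  = # 2 ∷ # 1 ∷ # 1 ∷ # 0 ∷ []
palette 7  = # 0 ∷ # 2 ∷ # 1 ∷ # 0 ∷ []
palette 8  = # 1 ∷ # 0 ∷ # 0 ∷ # 2 ∷ []
palette 9  = # 1 ∷ # 0 ∷ # 2 ∷ # 1 ∷ []
palette 10 = # 0 ∷ # 1 ∷ # 2 ∷ # 1 ∷ []
palette 11 = # 2 ∷ # 2 ∷ # 1 ∷ # 2 ∷ []
palette 12 = # 2 ∷ # 2 ∷ # 0 ∷ # 0 ∷ []
palette 13 = # 1 ∷ # 1 ∷ # 0 ∷ # 0 ∷ []
palette 14 = # 0 ∷ # 0 ∷ # 1 ∷ # 1 ∷ []
palette 15 = # 0 ∷ # 0 ∷ # 2 ∷ # 2 ∷ []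
palette (suc (suc (suc (suc (suc (suc (suc (suc (suc (suc (suc (suc v)))))))))))) = palette v

colouring : Fin 4 → ℕ → Fin 3
colouring i v = lookup (palette v) i

NonPivot : (Fin 5 → ℕ) → Fin 5 → Set
NonPivot K j = ∀ i → ¬ IsPivot (colouring i) K j

UniqueNonPivot : (Fin 5 → ℕ) → Set
UniqueNonPivot K = ∃ λ j → NonPivot K j × (∀ j′ → NonPivot K j′ → j′ ≡ j)

nonPivot? : ∀ K j → Dec (NonPivot K j)
nonPivot? K j = allFin? λ i → ¬? (colourCount (colouring i) K (colouring i (K j)) ℕ.≟ 1)

uniqueNonPivot? : ∀ K → Dec (UniqueNonPivot K)
uniqueNonPivot? K = any? λ j → nonPivot? K j ×-dec allFin? λ j′ → nonPivot? K j′ →-dec j′ F.≟ j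

colourCount-resp : ∀ {A B : Set} {φ : A → Fin 3} {ψ : B → Fin 3} {K L} →
                   (∀ j → φ (K j) ≡ ψ (L j)) → ∀ c → colourCount φ K c ≡ colourCount ψ L c
colourCount-resp eq c =
  cong sum (map-cong (λ j → cong (λ x → if ⌊ x F.≟ c ⌋ then 1 else 0) (eq j)) (allFin 5))

isPivot-resp : ∀ {A B : Set} {φ : A → Fin 3} {ψ : B → Fin 3} {K L} →
               (∀ j → φ (K j) ≡ ψ (L j)) → ∀ j → IsPivot φ K j → IsPivot ψ L j
isPivot-resp {φ = φ} {ψ} {K} {L} eq j p =
  trans (sym (colourCount-resp {φ = φ} {ψ} {K} {L} eq (ψ (L j))))
        (trans (cong (colourCount φ K) (sym (eq j))) p)

uniqueNonPivot-resp : ∀ K L → (∀ i j → colouring i (K j) ≡ colouring i (L j)) →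
                      UniqueNonPivot K → UniqueNonPivot L
uniqueNonPivot-resp K L eq (j , never , unique) = j , transfer never , λ j′ never′ → unique j′ (back never′)
  where
  transfer : ∀ {j} → NonPivot K j → NonPivot L j
  transfer {j} never i p = never i (isPivot-resp {φ = colouring i} {colouring i} {L} {K} (sym ∘ eq i) j p)
  back : ∀ {j} → NonPivot L j → NonPivot K j
  back {j} never i p = never i (isPivot-resp {φ = colouring i} {colouring i} {K} {L} (eq i) j p)

next : Fin 5 → Fin 5
next F.zero = # 1
next (F.suc F.zero) = # 2
next (F.suc (F.suc F.zero)) = # 3
next (F.suc (F.suc (F.suc F.zero))) = # 4
next (F.suc (F.suc (F.suc (F.suc F.zero)))) = # 0

ClosedWalk : ℕ → (Fin 5 → ℕ) → Set
ClosedWalk m K = ∀ j → T (adj m (K j) (K (next j)))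

SplitBy : ℕ → ℕ → ℕ → Set
SplitBy a b c = ∃ λ i → colouring i a ≡ colouring i b × colouring i c ≢ colouring i a

record Claw (m u a b c : ℕ) : Set where
  field
    distinct : a ≢ b × a ≢ c × b ≢ c
    legs     : T (adj m u a) × T (adj m u b) × T (adj m u c)
    only     : ∀ w → T (adj m u w) → w ≡ a ⊎ w ≡ b ⊎ w ≡ c

-- Since T'_k is triangle-free, a closed walk of length 5 is a 5-cycle; this is why faces need
-- not be assumed injective below.
record GoodColourings (m : ℕ) : Set where
  field
    proper : ∀ i u v → T (adj m u v) → colouring i u ≢ colouring i v
    pivots : ∀ K → ClosedWalk m K → UniqueNonPivot K
    claws  : ∀ u a b c → Claw m u a b c → SplitBy a b c

pentagon : ℕ → ℕ → ℕ → ℕ → ℕ → Fin 5 → ℕ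
pentagon a b c d e F.zero = a
pentagon a b c d e (F.suc F.zero) = b
pentagon a b c d e (F.suc (F.suc F.zero)) = c
pentagon a b c d e (F.suc (F.suc (F.suc F.zero))) = d
pentagon a b c d e (F.suc (F.suc (F.suc (F.suc F.zero)))) = e

pentagon-η : ∀ (K : Fin 5 → ℕ) j → pentagon (K (# 0)) (K (# 1)) (K (# 2)) (K (# 3)) (K (# 4)) j ≡ K j
pentagon-η K F.zero = refl
pentagon-η K (F.suc F.zero) = refl
pentagon-η K (F.suc (F.suc F.zero)) = refl
pentagon-η K (F.suc (F.suc (F.suc F.zero))) = refl
pentagon-η K (F.suc (F.suc (F.suc (F.suc F.zero)))) = refl

module Search (nb : ℕ → List ℕ) where

  ProperOn : List ℕ → Set
  ProperOn = All λ u → All (λ v → ∀ i → colouring i u ≢ colouring i v) (nb u)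

  PentagonsOn : List ℕ → Set
  PentagonsOn = All λ a → All (λ b → All (λ c → All (λ d → All (λ e →
    a ∈ nb e → UniqueNonPivot (pentagon a b c d e)) (nb d)) (nb c)) (nb b)) (nb a)

  ClawsOn : List ℕ → Set
  ClawsOn = All λ u → All (λ a → All (λ b → All (λ c →
    a ≢ b × a ≢ c × b ≢ c → All (λ w → w ≡ a ⊎ w ≡ b ⊎ w ≡ c) (nb u) → SplitBy a b c) (nb u)) (nb u)) (nb u)

  Verified : List ℕ → Set
  Verified vs = ProperOn vs × PentagonsOn vs × ClawsOn vs

  verified? : ∀ vs → Dec (Verified vs)
  verified? vs = all? proper? vs ×-dec all? pentagons? vs ×-dec all? claws? vs
    where
    proper? = λ u → all? (λ v → allFin? λ i → ¬? (colouring i u F.≟ colouring i v)) (nb u)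
    pentagons? = λ a → all? (λ b → all? (λ c → all? (λ d → all? (λ e →
      a ∈? nb e →-dec uniqueNonPivot? (pentagon a b c d e)) (nb d)) (nb c)) (nb b)) (nb a)
    splitBy? : ∀ a b c → Dec (SplitBy a b c)
    splitBy? a b c = any? λ i → colouring i a F.≟ colouring i b ×-dec ¬? (colouring i c F.≟ colouring i a)
    claws? = λ u → all? (λ a → all? (λ b → all? (λ c →
      (¬? (a ℕ.≟ b) ×-dec ¬? (a ℕ.≟ c) ×-dec ¬? (b ℕ.≟ c))
        →-dec (all? (λ w → w ℕ.≟ a ⊎-dec w ℕ.≟ b ⊎-dec w ℕ.≟ c) (nb u) →-dec splitBy? a b c)) (nb u)) (nb u)) (nb u)

nbrs : ℕ → ℕ → List ℕ
nbrs m u = filter (T? ∘ adj m u) (upTo (nV m))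

row : List (List ℕ) → ℕ → List ℕ
row [] _ = []
row (r ∷ rs) zero = r
row (r ∷ rs) (suc u) = row rs u

row-applyUpTo : ∀ (f : ℕ → List ℕ) {n u} → u < n → row (applyUpTo f n) u ≡ f u
row-applyUpTo f {suc n} {zero} _ = refl
row-applyUpTo f {suc n} {suc u} (s<s u<n) = row-applyUpTo (f ∘ suc) u<n

-- The search receives this table as an argument, so each neighbourhood is computed only once,
-- whereas calling nbrs m u would recompute it at every use.
nbrTable : ℕ → List (List ℕ)
nbrTable m = applyUpTo (nbrs m) (nV m)

module _ (m : ℕ) where
  open Search (row (nbrTable m))

  private
    vertex : ∀ {u v} → T (adj m u v) → u ∈ upTo (nV m)
    vertex {u} {v} t = ∈-upTo⁺ (adj-bounded m {v} {u} (adj-sym m {u} {v} t))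

    neighbour : ∀ {u v} → T (adj m u v) → v ∈ row (nbrTable m) u
    neighbour {u} {v} t =
      subst (v ∈_) (sym (row-applyUpTo (nbrs m) (adj-bounded m {v} {u} (adj-sym m {u} {v} t))))
        (∈-filter⁺ (T? ∘ adj m u) (∈-upTo⁺ (adj-bounded m {u} {v} t)) t)

    adjacent : ∀ {u v} → u < nV m → v ∈ row (nbrTable m) u → T (adj m u v)
    adjacent {u} {v} u< v∈ =
      proj₂ (∈-filter⁻ (T? ∘ adj m u) {xs = upTo (nV m)} (subst (v ∈_) (row-applyUpTo (nbrs m) u<) v∈))

  verified⇒good : Verified (upTo (nV m)) → GoodColourings m
  verified⇒good (proper , pentagons , claws) = record { proper = proper′ ; pivots = pivots′ ; claws = claws′ }
    where
    proper′ : ∀ i u v → T (adj m u v) → colouring i u ≢ colouring i v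
    proper′ i u v t = All.lookup (All.lookup proper (vertex {u} {v} t)) (neighbour {u} {v} t) i

    pivots′ : ∀ K → ClosedWalk m K → UniqueNonPivot K
    pivots′ K walk =
      uniqueNonPivot-resp (pentagon (K (# 0)) (K (# 1)) (K (# 2)) (K (# 3)) (K (# 4))) K
        (λ i j → cong (colouring i) (pentagon-η K j))
      (All.lookup (All.lookup (All.lookup (All.lookup (All.lookup pentagons (vertex {K (# 0)} {K (# 1)} (walk (# 0))))
        (neighbour {K (# 0)} {K (# 1)} (walk (# 0)))) (neighbour {K (# 1)} {K (# 2)} (walk (# 1))))
        (neighbour {K (# 2)} {K (# 3)} (walk (# 2)))) (neighbour {K (# 3)} {K (# 4)} (walk (# 3)))
        (neighbour {K (# 4)} {K (# 0)} (walk (# 4))))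

    claws′ : ∀ u a b c → Claw m u a b c → SplitBy a b c
    claws′ u a b c claw = All.lookup (All.lookup (All.lookup (All.lookup claws (vertex {u} {a} ua))
        (neighbour {u} {a} ua)) (neighbour {u} {b} ub)) (neighbour {u} {c} uc)
      distinct (All.tabulate λ {w} w∈ → only w (adjacent (adj-bounded m {a} {u} (adj-sym m {u} {a} ua)) w∈))
      where
      open Claw claw
      ua : T (adj m u a)
      ua = proj₁ legs
      ub : T (adj m u b)
      ub = proj₁ (proj₂ legs)
      uc : T (adj m u c)
      uc = proj₂ (proj₂ legs)

verified : ∀ m → {True (Search.verified? (row (nbrTable m)) (upTo (nV m)))} → GoodColourings m
verified m {ok} = verified⇒good m (toWitness ok)

good₈ : GoodColourings 8
good₈ = verified 8

data LowHigh (L : ℕ) : ℕ → Set where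
  low  : ∀ {u} → u < L → LowHigh L u
  high : ∀ x → LowHigh L (L + x)

lowHigh : ∀ L u → LowHigh L u
lowHigh zero u = high u
lowHigh (suc L) zero = low z<s
lowHigh (suc L) (suc u) with lowHigh L u
... | low u<L = low (s<s u<L)
... | high x = high x

within-two : ∀ j j′ → j′ ≡ j ⊎ j′ ≡ next j ⊎ j′ ≡ next (next j) ⊎ j ≡ next j′ ⊎ j ≡ next (next j′)
within-two = from-yes (allFin? λ j → allFin? λ j′ →
  j′ F.≟ j ⊎-dec j′ F.≟ next j ⊎-dec j′ F.≟ next (next j) ⊎-dec j F.≟ next j′ ⊎-dec j F.≟ next (next j′))

cycle-spread : ∀ {s} (K : Fin 5 → ℕ) → (∀ j → K (next j) ≤ s + K j) → (∀ j → K j ≤ s + K (next j)) →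
               ∀ j j′ → K j′ ≤ s + (s + K j)
cycle-spread {s} K fwd bwd j j′ with within-two j j′
... | inj₁ refl = ≤-trans (m≤n+m (K j) s) (m≤n+m (s + K j) s)
... | inj₂ (inj₁ refl) = ≤-trans (fwd j) (+-monoʳ-≤ s (m≤n+m (K j) s))
... | inj₂ (inj₂ (inj₁ refl)) = ≤-trans (fwd (next j)) (+-monoʳ-≤ s (fwd j))
... | inj₂ (inj₂ (inj₂ (inj₁ refl))) = ≤-trans (bwd j′) (m≤n+m (s + K (next j′)) s)
... | inj₂ (inj₂ (inj₂ (inj₂ refl))) = ≤-trans (bwd j′) (+-monoʳ-≤ s (bwd (next j′)))

module InductionStep (k : ℕ) (ih : GoodColourings (5 + k)) where
  open GoodColourings

  adj-low : ∀ {u} v → u ≤ 25 → adj (9 + k) u v ≡ adj 8 u v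
  adj-low v u≤ = adj-truncate {7} {8 + k} (≤-trans (n≤1+n 7) (m≤m+n 8 k)) v u≤

  down : ∀ {u} v → u ≤ 25 → T (adj (9 + k) u v) → T (adj 8 u v)
  down v u≤ = subst T (adj-low v u≤)

  up : ∀ {u} v → u ≤ 25 → T (adj 8 u v) → T (adj (9 + k) u v)
  up v u≤ = subst T (sym (adj-low v u≤))

  adj-high : ∀ a b → adj (9 + k) (17 + a) (17 + b) ≡ adj (5 + k) (5 + a) (5 + b)
  adj-high = adj-shift (4 + k)

  <17⇒≤25 : ∀ {u} → u < 17 → u ≤ 25
  <17⇒≤25 u<17 = ≤-trans (<⇒≤ u<17) (m≤m+n 17 8)

  proper-step : ∀ i u v → T (adj (9 + k) u v) → colouring i u ≢ colouring i v
  proper-step i u v t with lowHigh 17 u | lowHigh 17 v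
  ... | low u<17 | _ = proper good₈ i u v (down v (<17⇒≤25 u<17) t)
  ... | high _ | low v<17 = ≢-sym (proper good₈ i v u (down u (<17⇒≤25 v<17) (adj-sym (9 + k) {u} {v} t)))
  ... | high a | high b = proper ih i (5 + a) (5 + b) (subst T (adj-high a b) t)

  pivots-step : ∀ K → ClosedWalk (9 + k) K → UniqueNonPivot K
  pivots-step K walk with any? (λ j → K j <? 17)
  ... | yes (j , Kj<17) = pivots good₈ K λ j′ → down (K (next j′)) (near j′) (walk j′)
    where
    near : ∀ j′ → K j′ ≤ 25
    near j′ = ≤-trans (cycle-spread K fwd bwd j j′) (+-monoʳ-≤ 8 (<⇒≤ Kj<17))
      where
      fwd : ∀ j → K (next j) ≤ 4 + K j
      fwd j = adj-near (9 + k) {K j} {K (next j)} (walk j)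
      bwd : ∀ j → K j ≤ 4 + K (next j)
      bwd j = adj-near (9 + k) {K (next j)} {K j} (adj-sym (9 + k) {K j} {K (next j)} (walk j))
  ... | no none = uniqueNonPivot-resp K′ K (λ i j → cong (colouring i) (lifted j)) (pivots ih K′ walk′)
    where
    K′ : Fin 5 → ℕ
    K′ j = 5 + (K j ∸ 17)
    lifted : ∀ j → 17 + (K j ∸ 17) ≡ K j
    lifted j = m+[n∸m]≡n (≮⇒≥ λ Kj<17 → none (j , Kj<17))
    walk′ : ClosedWalk (5 + k) K′
    walk′ j = subst T (adj-high _ _)
      (subst₂ (λ x y → T (adj (9 + k) x y)) (sym (lifted j)) (sym (lifted (next j))) (walk j))

  leg-high : ∀ x {a} → T (adj (9 + k) (21 + x) a) → ∃ λ a′ → a ≡ 17 + a′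
  leg-high x {a} t with lowHigh 17 a
  ... | high a′ = a′ , refl
  ... | low a<17 = ⊥-elim (<⇒≱ (+-monoʳ-< 4 a<17)
                     (≤-trans (m≤m+n 21 x) (adj-near (9 + k) {a} {21 + x} (adj-sym (9 + k) {21 + x} {a} t))))

  claw-high : ∀ x a′ b′ c′ → Claw (9 + k) (21 + x) (17 + a′) (17 + b′) (17 + c′) →
              Claw (5 + k) (9 + x) (5 + a′) (5 + b′) (5 + c′)
  claw-high x a′ b′ c′ claw = record
    { distinct = unshift a≢b , unshift a≢c , unshift b≢c
    ; legs = shift a′ ua , shift b′ ub , shift c′ uc
    ; only = only′
    }
    where
    open Claw claw
    a≢b : 17 + a′ ≢ 17 + b′
    a≢b = proj₁ distinct
    a≢c : 17 + a′ ≢ 17 + c′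
    a≢c = proj₁ (proj₂ distinct)
    b≢c : 17 + b′ ≢ 17 + c′
    b≢c = proj₂ (proj₂ distinct)
    ua : T (adj (9 + k) (21 + x) (17 + a′))
    ua = proj₁ legs
    ub : T (adj (9 + k) (21 + x) (17 + b′))
    ub = proj₁ (proj₂ legs)
    uc : T (adj (9 + k) (21 + x) (17 + c′))
    uc = proj₂ (proj₂ legs)
    unshift : ∀ {a b} → 17 + a ≢ 17 + b → 5 + a ≢ 5 + b
    unshift ne = ne ∘ cong (12 +_)
    shift : ∀ a → T (adj (9 + k) (21 + x) (17 + a)) → T (adj (5 + k) (9 + x) (5 + a))
    shift a = subst T (adj-high (4 + x) a)
    drop : ∀ {a b} → 17 + a ≡ 17 + b → 5 + a ≡ 5 + b
    drop = cong (_∸ 12)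
    only′ : ∀ w → T (adj (5 + k) (9 + x) w) → w ≡ 5 + a′ ⊎ w ≡ 5 + b′ ⊎ w ≡ 5 + c′
    only′ w t with lowHigh 5 w
    ... | low w<5 = ⊥-elim (<⇒≱ (+-monoʳ-< 4 w<5)
                     (≤-trans (m≤m+n 9 x) (adj-near (5 + k) {w} {9 + x} (adj-sym (5 + k) {9 + x} {w} t))))
    ... | high w′ = Sum.map drop (Sum.map drop drop)
                      (only (17 + w′) (subst T (sym (adj-high (4 + x) w′)) t))

  claws-step : ∀ u a b c → Claw (9 + k) u a b c → SplitBy a b c
  claws-step u a b c claw with lowHigh 21 u
  ... | low u<21 = claws good₈ u a b c record
    { distinct = distinct
    ; legs = down a u≤25 (proj₁ legs) , down b u≤25 (proj₁ (proj₂ legs)) , down c u≤25 (proj₂ (proj₂ legs))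
    ; only = λ w t → only w (up w u≤25 t)
    }
    where
    open Claw claw
    u≤25 : u ≤ 25
    u≤25 = ≤-trans (<⇒≤ u<21) (m≤m+n 21 4)
  ... | high x with leg-high x {a} (proj₁ (Claw.legs claw)) | leg-high x {b} (proj₁ (proj₂ (Claw.legs claw)))
                  | leg-high x {c} (proj₂ (proj₂ (Claw.legs claw)))
  ...   | a′ , refl | b′ , refl | c′ , refl =
    claws ih (9 + x) (5 + a′) (5 + b′) (5 + c′) (claw-high x a′ b′ c′ claw)

  good-step : GoodColourings (9 + k)
  good-step = record { proper = proper-step ; pivots = pivots-step ; claws = claws-step }

good : ∀ m → GoodColourings m
good 0 = verified 0
good 1 = verified 1
good 2 = verified 2
good 3 = verified 3
good 4 = verified 4
good 5 = verified 5
good 6 = verified 6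
good 7 = verified 7
good 8 = good₈
good (suc (suc (suc (suc (suc (suc (suc (suc (suc k))))))))) =
  InductionStep.good-step k (good (suc (suc (suc (suc (suc k))))))

Adj-sym : ∀ G {u v} → Adj G u v → Adj G v u
Adj-sym G {u} {v} = subst T (adjB-sym (E G) (toℕ u) (toℕ v))

facial-darts : ∀ G (emb : PlaneEmbedding G) {d} → IsDart G d →
               ∀ r → IsDart G (iter (faceNext G (rot emb)) r d)
facial-darts G emb isDart zero = isDart
facial-darts G emb {d} isDart (suc r) = rot-closed emb v u (Adj-sym G {u} {v} (facial-darts G emb {d} isDart r))
  where
  u v : Fin (n G)
  u = proj₁ (iter (faceNext G (rot emb)) r d)
  v = proj₂ (iter (faceNext G (rot emb)) r d)

facial-walk : ∀ G (emb : PlaneEmbedding G) {d} → FiveFace G emb d →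
              ∀ j → Adj G (faceVertex G emb d j) (faceVertex G emb d (next j))
facial-walk G emb {d} (isDart , _ , _) F.zero = facial-darts G emb {d} isDart 0
facial-walk G emb {d} (isDart , _ , _) (F.suc F.zero) = facial-darts G emb {d} isDart 1
facial-walk G emb {d} (isDart , _ , _) (F.suc (F.suc F.zero)) = facial-darts G emb {d} isDart 2
facial-walk G emb {d} (isDart , _ , _) (F.suc (F.suc (F.suc F.zero))) = facial-darts G emb {d} isDart 3
facial-walk G emb {d} (isDart , closed , _) (F.suc (F.suc (F.suc (F.suc F.zero)))) =
  subst (λ d′ → Adj G (faceVertex G emb d (# 4)) (proj₁ d′)) closed (facial-darts G emb {d} isDart 4)

claw-toℕ : ∀ m {u a b c : Fin (nV m)} → a ≢ b → a ≢ c → b ≢ c →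
           Adj (RTW m) u a → Adj (RTW m) u b → Adj (RTW m) u c →
           (∀ w → Adj (RTW m) u w → w ≡ a ⊎ w ≡ b ⊎ w ≡ c) →
           Claw m (toℕ u) (toℕ a) (toℕ b) (toℕ c)
claw-toℕ m {u} {a} {b} {c} a≢b a≢c b≢c ua ub uc only = record
  { distinct = a≢b ∘ toℕ-injective , a≢c ∘ toℕ-injective , b≢c ∘ toℕ-injective
  ; legs = ua , ub , uc
  ; only = only′
  }
  where
  only′ : ∀ w → T (adj m (toℕ u) w) → w ≡ toℕ a ⊎ w ≡ toℕ b ⊎ w ≡ toℕ c
  only′ w t = Sum.map back (Sum.map back back)
    (only (fromℕ< w<) (subst (T ∘ adj m (toℕ u)) (sym (toℕ-fromℕ< w<)) t))
    where
    w< : w < nV m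
    w< = adj-bounded m {toℕ u} {w} t
    back : ∀ {x} → fromℕ< w< ≡ x → w ≡ toℕ x
    back eq = trans (sym (toℕ-fromℕ< w<)) (cong toℕ eq)

lemma28 : (m : ℕ) (emb : PlaneEmbedding (RTW m)) →
    Σ (Fin 4 → Colouring (RTW m)) λ φ →
      (∀ i → Proper (RTW m) (φ i))
      × (∀ d → FiveFace (RTW m) emb d →
           ∃ λ j → (∀ i → ¬ IsPivot (φ i) (faceVertex (RTW m) emb d) j)
             × (∀ j′ → (∀ i → ¬ IsPivot (φ i) (faceVertex (RTW m) emb d) j′) → j′ ≡ j))
      × (∀ u a b c → a ≢ b → a ≢ c → b ≢ c →
           Adj (RTW m) u a → Adj (RTW m) u b → Adj (RTW m) u c →
           (∀ w → Adj (RTW m) u w → w ≡ a ⊎ w ≡ b ⊎ w ≡ c) →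
           ∃ λ i → φ i a ≡ φ i b × φ i c ≢ φ i a)
lemma28 m emb =
  (λ i v → colouring i (toℕ v)) ,
  (λ i u v → proper i (toℕ u) (toℕ v)) ,
  (λ d face → pivots (toℕ ∘ faceVertex (RTW m) emb d) (facial-walk (RTW m) emb face)) ,
  λ u a b c a≢b a≢c b≢c ua ub uc only →
    claws (toℕ u) (toℕ a) (toℕ b) (toℕ c) (claw-toℕ m a≢b a≢c b≢c ua ub uc only)
  where
  open GoodColourings (good m)
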